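{- Let $k\geq 3$, $\ell\geq 2$, $p\geq 2$, let $n$ be sufficiently large, and let $G$ be an extremal graph for $C_{k,\ell}^{p+1}$ on $n$ vertices with $G\in\mathbb{D}(n,p,r)$, equipped with a decomposition as described in the context, in which each block $H_i$ ($1\leq i\leq p$) is a single vertex. Then for each $i$, every vertex in $B_i$ is adjacent to all vertices of $V(G')\setminus A_i$.
   Context: Graphs are finite and simple. For a graph $H$ and $p\geq 2$, the edge blow-up $H^{p+1}$ replaces each edge by a clique of order $p+1$ with all new vertices distinct. The lollipop $C_{k,\ell}$ is obtained from a cycle $C_k$ by identifying one endpoint of a path $P_{\ell+1}$ with a vertex of the cycle. An extremal graph for $F$ is an $F$-free $n$-vertex graph with the maximum number of edges. Two subgraphs $H_1,H_2$ of $G$ are symmetric if $H_1=H_2$, or if they are vertex-disjoint, there are no edges between them, and there is an isomorphism $\omega:H_1\to H_2$ such that every $x\in V(H_1)$ and $u\in V(G)\setminus(V(H_1)\cup V(H_2))$ satisfy $xu\in E(G)\iff \omega(x)u\in E(G)$. $\mathbb{D}(n,p,r)$ is the family of $n$-vertex graphs $G$ such that one can delete at most $r$ vertices so that the remaining graph is $G'=G^1\vee\cdots\vee G^p$ (join) with $|V(G^i)|=n_i$, $|n_i-n/p|\leq r$, and each $G^i$ is a disjoint union of $k_i$ copies of a connected graph $H_i$ (the block), any two of these copies being symmetric subgraphs of $G$. Here $r$ is a constant depending only on $k,\ell,p$. Set $A_i=V(G^i)$; $W$ is the set of vertices of $G-G'$ adjacent to all vertices of $G'$; $B_i$ is the set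 of vertices of $G-G'-W$ adjacent to no vertex of $A_i$. -}

module Defs where

open import Data.Nat using (ℕ; zero; suc; _+_; _*_; _∸_; _≤_; _<_; _<ᵇ_)
open import Data.Nat.Properties using (_<?_)
open import Data.Fin using (Fin; zero; suc; toℕ; fromℕ<; inject₁; _≟_)
open import Data.Bool using (Bool; true; false; T; if_then_else_; _∧_)
open import Data.List using (List; map; allFin)
open import Data.Nat.ListAction using (sum)
open import Data.Maybe using (Maybe; just; nothing)
open import Data.Product using (Σ; _×_; _,_; proj₁; proj₂)
open import Data.Sum using (_⊎_; inj₁; inj₂)
open import Data.Empty using (⊥)
open import Relation.Nullary using (¬_; yes; no)
open import Relation.Nullary.Decidable using (⌊_⌋)
open import Relation.Binary.PropositionalEquality using (_≡_; _≢_)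

record Graph (n : ℕ) : Set where
  field
    adj    : Fin n → Fin n → Bool
    sym    : ∀ u v → adj u v ≡ adj v u
    irrefl : ∀ v → adj v v ≡ false
open Graph public

count : ∀ {n} → (Fin n → Bool) → ℕ
count {n} P = sum (map (λ i → if P i then 1 else 0) (allFin n))

edges : ∀ {n} → Graph n → ℕ
edges {n} G = sum (map (λ i → count (λ j → (toℕ i <ᵇ toℕ j) ∧ adj G i j)) (allFin n))

record PatternGraph : Set₁ where
  field
    V    : Set
    E    : Set
    ends : E → V × V
open PatternGraph public

-- Edge blow-up H^{p+1}: every edge e = uv gets p-1 new private vertices
-- (e , s), s : Fin (p ∸ 1), which together with u, v form a clique K_{p+1}.
BlowV : PatternGraph → ℕ → Set
BlowV H p = V H ⊎ (E H × Fin (p ∸ 1))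

data BlowAdj (H : PatternGraph) (p : ℕ) : BlowV H p → BlowV H p → Set where
  old : ∀ e → BlowAdj H p (inj₁ (proj₁ (ends H e))) (inj₁ (proj₂ (ends H e)))
  newˡ : ∀ e s → BlowAdj H p (inj₂ (e , s)) (inj₁ (proj₁ (ends H e)))
  newʳ : ∀ e s → BlowAdj H p (inj₂ (e , s)) (inj₁ (proj₂ (ends H e)))
  new-new : ∀ e s t → s ≢ t → BlowAdj H p (inj₂ (e , s)) (inj₂ (e , t))

Contains : ∀ {n} → Graph n → (W : Set) → (W → W → Set) → Set
Contains {n} G W R =
  Σ (W → Fin n) λ f → (∀ x y → f x ≡ f y → x ≡ y) × (∀ x y → R x y → T (adj G (f x) (f y)))

BlowFree : ∀ {n} → PatternGraph → ℕ → Graph n → Set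
BlowFree H p G = ¬ Contains G (BlowV H p) (BlowAdj H p)

Extremal : ∀ {n} → PatternGraph → ℕ → Graph n → Set
Extremal {n} H p G = BlowFree H p G × (∀ (G' : Graph n) → BlowFree H p G' → edges G' ≤ edges G)

-- Lollipop C_{k,ℓ}: cycle on Fin k (edges i ~ i+1 mod k), plus a path
-- 0 - p₀ - p₁ - ... - p_{ℓ-1} attached at cycle vertex 0 (ℓ new vertices,
-- ℓ edges).  (k = 0 gives a junk value; only k ≥ 3 is used.)

nextC : ∀ {k} → Fin k → Fin k
nextC {suc k} i with suc (toℕ i) <? suc k
... | yes q = fromℕ< q
... | no _  = zero

prevP : ∀ {k ℓ} → Fin ℓ → Fin (suc k) ⊎ Fin ℓ
prevP zero    = inj₁ zero
prevP (suc j) = inj₂ (inject₁ j)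

lollipop : ℕ → ℕ → PatternGraph
lollipop zero    ℓ = record { V = ⊥ ; E = ⊥ ; ends = λ () }
lollipop (suc k) ℓ = record
  { V = Fin (suc k) ⊎ Fin ℓ
  ; E = Fin (suc k) ⊎ Fin ℓ
  ; ends = λ { (inj₁ i) → inj₁ i , inj₁ (nextC i)
             ; (inj₂ j) → prevP {k} j , inj₂ j }
  }

-- Membership of G in 𝔻(n,p,r) with a decomposition in which every block
-- H_i is a single vertex.  part v = nothing : v is deleted (v ∉ G');
-- part v = just i : v ∈ A_i.

inA : ∀ {n p} → (Fin n → Maybe (Fin p)) → Fin p → Fin n → Bool
inA part i v with part v
... | just j  = ⌊ j ≟ i ⌋
... | nothing = false

isDeleted : ∀ {n p} → (Fin n → Maybe (Fin p)) → Fin n → Bool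
isDeleted part v with part v
... | just _  = false
... | nothing = true

record SingletonDecomp {n : ℕ} (G : Graph n) (p r : ℕ) : Set where
  field
    part : Fin n → Maybe (Fin p)
    few-deleted : count (isDeleted part) ≤ r
    -- | n_i - n/p | ≤ r, written as | p n_i - n | ≤ p r
    size-lo : ∀ i → n ≤ p * count (inA part i) + p * r
    size-hi : ∀ i → p * count (inA part i) ≤ n + p * r
    join : ∀ u v i j → part u ≡ just i → part v ≡ just j → i ≢ j → T (adj G u v)
    indep : ∀ u v i → part u ≡ just i → part v ≡ just i → adj G u v ≡ false
    symm : ∀ x y i → part x ≡ just i → part y ≡ just i → x ≢ y →
           ∀ u → u ≢ x → u ≢ y → adj G x u ≡ adj G y u
open SingletonDecomp public

InW : ∀ {n p r} {G : Graph n} → SingletonDecomp G p r → Fin n → Set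
InW {G = G} D v = part D v ≡ nothing × (∀ u i → part D u ≡ just i → T (adj G v u))

InB : ∀ {n p r} {G : Graph n} → SingletonDecomp G p r → Fin p → Fin n → Set
InB {G = G} D i v =
  part D v ≡ nothing × ¬ InW D v × (∀ u → part D u ≡ just i → adj G v u ≡ false)

-- Suppose v ∈ Bᵢ is not adjacent to some u ∈ Aⱼ, j ≠ i. The vertices of Aⱼ
-- are symmetric, so v has no neighbour in Aᵢ ∪ Aⱼ, while a vertex w ∈ Aᵢ is
-- adjacent to all of G' outside Aᵢ. Counting vertex by vertex, and using that
-- v is deleted and not adjacent to w,
--   deg v + |Aⱼ| < deg w + #deleted ≤ deg w + r ≤ deg w + |Aⱼ|,
-- so the Zykov symmetrization replacing v by a false twin of w gains edges.
-- It is still free of the blow-up: Aᵢ has more vertices than the blow-up, so a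
-- copy misses some w' ∈ Aᵢ, and sending v to w' instead of w gives a copy in G.
module Submission where

open import Defs hiding (sym)
open import Data.Bool using (Bool; true; false; T; if_then_else_; _∧_; _∨_)
open import Data.Empty using (⊥-elim)
open import Data.Fin using (Fin; zero; suc; toℕ; punchIn; _≟_; _<?_)
open import Data.Fin.Properties using (punchInᵢ≢i; <-cmp; ¬∀⟶∃¬)
open import Data.List using (List; []; _∷_; map; length; _++_; allFin; tabulate; cartesianProduct)
open import Data.List.Membership.Propositional using (_∈_; _∉_)
open import Data.List.Membership.Propositional.Properties
  using (∈-map⁺; ∈-++⁺ˡ; ∈-++⁺ʳ; ∈-allFin; ∈-cartesianProduct⁺)
open import Data.List.Properties using (map-tabulate; length-map)
open import Data.List.Relation.Unary.Any using (any?)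
open import Data.Maybe using (just; nothing)
open import Data.Nat using (ℕ; zero; suc; _+_; _*_; _∸_; _≤_; _<_; _<ᵇ_; z≤n; s≤s; NonZero)
open import Data.Nat.Properties
  using (+-0-commutativeMonoid; ≤-refl; ≤-trans; ≤-reflexive; <⇒≱; +-identityʳ; +-assoc;
         +-mono-≤; +-mono-<-≤; +-monoˡ-≤; +-monoʳ-≤; <⇒≤; +-cancelʳ-<; +-cancelʳ-≤; *-cancelˡ-≤; m≤n+m; m≤m+n;
         module ≤-Reasoning)
import Data.Nat.ListAction as List
open import Algebra.Properties.CommutativeMonoid.Sum +-0-commutativeMonoid
  using (sum; sum-cong-≗; ∑-distrib-+; sum-remove; sum-replicate-zero)
open import Data.Product using (Σ; ∃-syntax; _×_; _,_; proj₁; proj₂)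
open import Data.Sum using (_⊎_; inj₁; inj₂)
open import Data.Unit using (tt)
open import Function using (_∘_; case_of_)
open import Relation.Binary.Definitions using (tri<; tri≈; tri>)
open import Relation.Binary.PropositionalEquality
open import Relation.Nullary using (¬_; Dec; yes; no; does; _→-dec_)
open import Relation.Nullary.Decidable using (dec-true; dec-false; T?)

-- Finite sums and a pigeonhole principle

𝟙 : Bool → ℕ
𝟙 b = if b then 1 else 0

𝟙≤1 : ∀ b → 𝟙 b ≤ 1
𝟙≤1 true  = ≤-refl
𝟙≤1 false = z≤n

𝟙-T : ∀ {b} → T b → 𝟙 b ≡ 1
𝟙-T {true} _ = refl

𝟙-∨ : ∀ a b → 𝟙 (a ∨ b) ≤ 𝟙 a + 𝟙 b
𝟙-∨ true  b = s≤s z≤n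
𝟙-∨ false b = ≤-refl

sum-tabulate : ∀ {n} (f : Fin n → ℕ) → List.sum (tabulate f) ≡ sum f
sum-tabulate {zero}  f = refl
sum-tabulate {suc n} f = cong (f zero +_) (sum-tabulate (f ∘ suc))

sum-map-allFin : ∀ {n} (f : Fin n → ℕ) → List.sum (map f (allFin n)) ≡ sum f
sum-map-allFin f = trans (cong List.sum (map-tabulate (λ i → i) f)) (sum-tabulate f)

count≡sum : ∀ {n} (P : Fin n → Bool) → count P ≡ sum (𝟙 ∘ P)
count≡sum P = sum-map-allFin (𝟙 ∘ P)

sum-zero : ∀ {n} {f : Fin n → ℕ} → (∀ i → f i ≡ 0) → sum f ≡ 0
sum-zero {n} f≡0 = trans (sum-cong-≗ f≡0) (sum-replicate-zero n)

∑-mono-≤ : ∀ {n} {f g : Fin n → ℕ} → (∀ i → f i ≤ g i) → sum f ≤ sum g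
∑-mono-≤ {zero}  f≤g = z≤n
∑-mono-≤ {suc n} f≤g = +-mono-≤ (f≤g zero) (∑-mono-≤ (f≤g ∘ suc))

∑-mono-< : ∀ {n} {f g : Fin n → ℕ} → (∀ i → f i ≤ g i) → ∀ k → f k < g k → sum f < sum g
∑-mono-< {suc n} {f} {g} f≤g k fk<gk = begin-strict
  sum f                       ≡⟨ sum-remove {i = k} f ⟩
  f k + sum (f ∘ punchIn k)   <⟨ +-mono-<-≤ fk<gk (∑-mono-≤ (f≤g ∘ punchIn k)) ⟩
  g k + sum (g ∘ punchIn k)   ≡⟨ sum-remove {i = k} g ⟨
  sum g                       ∎
  where open ≤-Reasoning

∑-indicator : ∀ {n} (y : Fin n) → sum (λ z → 𝟙 (does (z ≟ y))) ≡ 1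
∑-indicator {suc n} y = begin
  sum (λ z → 𝟙 (does (z ≟ y)))                      ≡⟨ sum-remove {i = y} (λ z → 𝟙 (does (z ≟ y))) ⟩
  𝟙 (does (y ≟ y)) + sum (λ a → 𝟙 (does (punchIn y a ≟ y)))
    ≡⟨ cong₂ _+_ (cong 𝟙 (dec-true (y ≟ y) refl))
                 (sum-zero (λ a → cong 𝟙 (dec-false (punchIn y a ≟ y) (punchInᵢ≢i y a)))) ⟩
  1                                                  ∎
  where open ≡-Reasoning

∑-∈-≤-length : ∀ {n} (xs : List (Fin n)) → sum (λ z → 𝟙 (does (any? (z ≟_) xs))) ≤ length xs
∑-∈-≤-length {n} [] = ≤-reflexive (sum-replicate-zero n)
∑-∈-≤-length (y ∷ ys) = begin
  sum (λ z → 𝟙 (does (z ≟ y) ∨ does (any? (z ≟_) ys)))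
    ≤⟨ ∑-mono-≤ (λ z → 𝟙-∨ (does (z ≟ y)) _) ⟩
  sum (λ z → 𝟙 (does (z ≟ y)) + 𝟙 (does (any? (z ≟_) ys)))
    ≡⟨ ∑-distrib-+ (λ z → 𝟙 (does (z ≟ y))) (λ z → 𝟙 (does (any? (z ≟_) ys))) ⟩
  sum (λ z → 𝟙 (does (z ≟ y))) + sum (λ z → 𝟙 (does (any? (z ≟_) ys)))
    ≤⟨ +-mono-≤ (≤-reflexive (∑-indicator y)) (∑-∈-≤-length ys) ⟩
  suc (length ys) ∎
  where open ≤-Reasoning

count-≤-length : ∀ {n} (P : Fin n → Bool) (xs : List (Fin n)) →
                 (∀ z → T (P z) → z ∈ xs) → count P ≤ length xs
count-≤-length P xs P⊆xs = begin
  count P                                      ≡⟨ count≡sum P ⟩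
  sum (𝟙 ∘ P)                                  ≤⟨ ∑-mono-≤ 𝟙P≤𝟙∈ ⟩
  sum (λ z → 𝟙 (does (any? (z ≟_) xs)))        ≤⟨ ∑-∈-≤-length xs ⟩
  length xs                                    ∎
  where
  open ≤-Reasoning
  𝟙P≤𝟙∈ : ∀ z → 𝟙 (P z) ≤ 𝟙 (does (any? (z ≟_) xs))
  𝟙P≤𝟙∈ z with P z in Pz
  ... | false = z≤n
  ... | true  = ≤-reflexive (cong 𝟙 (sym (dec-true (any? (z ≟_) xs) (P⊆xs z (subst T (sym Pz) tt)))))

∃-∉ : ∀ {n} (P : Fin n → Bool) (xs : List (Fin n)) → length xs < count P →
      ∃[ z ] T (P z) × z ∉ xs
∃-∉ {n} P xs xs<P
  with z , z∉ ← ¬∀⟶∃¬ n _ (λ z → T? (P z) →-dec any? (z ≟_) xs)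
                         (λ P⊆xs → <⇒≱ xs<P (count-≤-length P xs P⊆xs))
  with T? (P z)
... | yes Pz  = z , Pz , λ z∈ → z∉ (λ _ → z∈)
... | no  ¬Pz = ⊥-elim (z∉ (⊥-elim ∘ ¬Pz))

-- Edges through a vertex

degree : ∀ {n} → Graph n → Fin n → ℕ
degree G v = sum (λ z → 𝟙 (adj G v z))

ordered : ∀ {n} → Graph n → Fin n → Fin n → ℕ
ordered G a b = 𝟙 ((toℕ a <ᵇ toℕ b) ∧ adj G a b)

edges≡sum : ∀ {n} (G : Graph n) → edges G ≡ sum (λ a → sum (ordered G a))
edges≡sum {n} G = trans (sum-map-allFin (λ a → count (after a))) (sum-cong-≗ (λ a → count≡sum (after a)))
  where
  after : Fin n → Fin n → Bool
  after a b = (toℕ a <ᵇ toℕ b) ∧ adj G a b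

private
  <ᵇ-true : ∀ {n} {a b : Fin n} → a Data.Fin.< b → (toℕ a <ᵇ toℕ b) ≡ true
  <ᵇ-true {a = a} {b} = dec-true (a <? b)

  <ᵇ-false : ∀ {n} {a b : Fin n} → ¬ a Data.Fin.< b → (toℕ a <ᵇ toℕ b) ≡ false
  <ᵇ-false {a = a} {b} = dec-false (a <? b)

ordered-+-flip : ∀ {n} (G : Graph n) a b → ordered G a b + ordered G b a ≡ 𝟙 (adj G a b)
ordered-+-flip G a b with <-cmp a b
... | tri< a<b _ b≮a rewrite <ᵇ-true a<b | <ᵇ-false b≮a = +-identityʳ _
... | tri≈ a≮a refl _ rewrite <ᵇ-false a≮a | irrefl G a = refl
... | tri> a≮b _ b<a rewrite <ᵇ-false a≮b | <ᵇ-true b<a = cong 𝟙 (Graph.sym G b a)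

degree≡sum-ordered : ∀ {n} (G : Graph (suc n)) v →
  degree G v ≡ sum (ordered G v) + sum (λ a → ordered G (punchIn v a) v)
degree≡sum-ordered G v = begin
  degree G v                                              ≡⟨ sum-cong-≗ (ordered-+-flip G v) ⟨
  sum (λ b → ordered G v b + ordered G b v)               ≡⟨ ∑-distrib-+ (ordered G v) (λ b → ordered G b v) ⟩
  sum (ordered G v) + sum (λ b → ordered G b v)           ≡⟨ cong (sum (ordered G v) +_) (sum-remove {i = v} (λ b → ordered G b v)) ⟩
  sum (ordered G v) + (ordered G v v + sum (λ a → ordered G (punchIn v a) v))
    ≡⟨ cong (λ x → sum (ordered G v) + (x + sum (λ a → ordered G (punchIn v a) v))) ordered-loop ⟩
  sum (ordered G v) + sum (λ a → ordered G (punchIn v a) v) ∎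
  where
  open ≡-Reasoning
  ordered-loop : ordered G v v ≡ 0
  ordered-loop rewrite <ᵇ-false (Data.Fin.Properties.<-irrefl {x = v} refl) = refl

edgesAvoiding : ∀ {n} → Graph (suc n) → Fin (suc n) → ℕ
edgesAvoiding G v = sum (λ a → sum (λ b → ordered G (punchIn v a) (punchIn v b)))

edges≡degree+edgesAvoiding : ∀ {n} (G : Graph (suc n)) v → edges G ≡ degree G v + edgesAvoiding G v
edges≡degree+edgesAvoiding G v = begin
  edges G                                                    ≡⟨ edges≡sum G ⟩
  sum (λ a → sum (ordered G a))                              ≡⟨ sum-remove {i = v} (λ a → sum (ordered G a)) ⟩
  sum (ordered G v) + sum (λ a → sum (ordered G (punchIn v a)))
    ≡⟨ cong (sum (ordered G v) +_) (trans (sum-cong-≗ (λ a → sum-remove {i = v} (ordered G (punchIn v a))))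
                                      (∑-distrib-+ (λ a → ordered G (punchIn v a) v) _)) ⟩
  sum (ordered G v) + (sum (λ a → ordered G (punchIn v a) v) + edgesAvoiding G v)
    ≡⟨ +-assoc (sum (ordered G v)) (sum (λ a → ordered G (punchIn v a) v)) (edgesAvoiding G v) ⟨
  sum (ordered G v) + sum (λ a → ordered G (punchIn v a) v) + edgesAvoiding G v
    ≡⟨ cong (_+ edgesAvoiding G v) (degree≡sum-ordered G v) ⟨
  degree G v + edgesAvoiding G v                             ∎
  where open ≡-Reasoning

edges-<-of-degree-< : ∀ {n} (G G' : Graph n) v →
  (∀ a b → a ≢ v → b ≢ v → adj G a b ≡ adj G' a b) →
  degree G v < degree G' v → edges G < edges G'
edges-<-of-degree-< {suc n} G G' v agree deg< = begin-strict
  edges G                        ≡⟨ edges≡degree+edgesAvoiding G v ⟩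
  degree G v + edgesAvoiding G v   <⟨ +-mono-<-≤ deg< (≤-reflexive avoiding≡) ⟩
  degree G' v + edgesAvoiding G' v ≡⟨ edges≡degree+edgesAvoiding G' v ⟨
  edges G'                       ∎
  where
  open ≤-Reasoning
  avoiding≡ : edgesAvoiding G v ≡ edgesAvoiding G' v
  avoiding≡ = sum-cong-≗ λ a → sum-cong-≗ λ b →
    cong (λ x → 𝟙 ((toℕ (punchIn v a) <ᵇ toℕ (punchIn v b)) ∧ x))
         (agree _ _ (punchInᵢ≢i v a) (punchInᵢ≢i v b))

-- Zykov symmetrization

pullback : ∀ {m n} → (Fin m → Fin n) → Graph n → Graph m
pullback f G = record
  { adj    = λ a b → adj G (f a) (f b)
  ; sym    = λ a b → Graph.sym G (f a) (f b)
  ; irrefl = λ a → irrefl G (f a)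
  }

redirect : ∀ {n} → Fin n → Fin n → Fin n → Fin n
redirect v w z with z ≟ v
... | yes _ = w
... | no  _ = z

redirect-self : ∀ {n} (v w : Fin n) → redirect v w v ≡ w
redirect-self v w with v ≟ v
... | yes _  = refl
... | no v≢v = ⊥-elim (v≢v refl)

redirect-≢ : ∀ {n} {v w z : Fin n} → z ≢ v → redirect v w z ≡ z
redirect-≢ {v = v} {z = z} z≢v with z ≟ v
... | yes z≡v = ⊥-elim (z≢v z≡v)
... | no  _   = refl

redirect-injective-off : ∀ {n} (v w : Fin n) {a b : Fin n} → a ≢ w → b ≢ w →
                         redirect v w a ≡ redirect v w b → a ≡ b
redirect-injective-off v w {a} {b} a≢w b≢w eq with a ≟ v | b ≟ v
... | yes a≡v | yes b≡v = trans a≡v (sym b≡v)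
... | yes _   | no  _   = ⊥-elim (b≢w (sym eq))
... | no  _   | yes _   = ⊥-elim (a≢w eq)
... | no  _   | no  _   = eq

-- v is replaced by a copy of w, nonadjacent to w
symmetrize : ∀ {n} → Graph n → Fin n → Fin n → Graph n
symmetrize G v w = pullback (redirect v w) G

symmetrize-agrees-off : ∀ {n} (G : Graph n) (v w : Fin n) {a b : Fin n} → a ≢ v → b ≢ v →
                        adj G a b ≡ adj (symmetrize G v w) a b
symmetrize-agrees-off G v w a≢v b≢v = sym (cong₂ (adj G) (redirect-≢ a≢v) (redirect-≢ b≢v))

degree-symmetrize : ∀ {n} (G : Graph n) (v w : Fin n) → adj G w v ≡ false →
                    degree (symmetrize G v w) v ≡ degree G w
degree-symmetrize G v w w≁v = sum-cong-≗ λ b → cong 𝟙 (adj-v b (b ≟ v))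
  where
  adj-v : ∀ b → Dec (b ≡ v) → adj G (redirect v w v) (redirect v w b) ≡ adj G w b
  adj-v b (yes refl) rewrite redirect-self v w = trans (irrefl G w) (sym w≁v)
  adj-v b (no b≢v)   = cong₂ (adj G) (redirect-self v w) (redirect-≢ b≢v)

edges-symmetrize : ∀ {n} (G : Graph n) (v w : Fin n) → adj G w v ≡ false →
                   degree G v < degree G w → edges G < edges (symmetrize G v w)
edges-symmetrize G v w w≁v deg< =
  edges-<-of-degree-< G (symmetrize G v w) v (λ a b → symmetrize-agrees-off G v w)
    (subst (degree G v <_) (sym (degree-symmetrize G v w w≁v)) deg<)

FalseTwins : ∀ {n} → Graph n → Fin n → Fin n → Set
FalseTwins G w w' = adj G w w' ≡ false × (∀ b → b ≢ w → b ≢ w' → adj G w b ≡ adj G w' b)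

FalseTwins-adj : ∀ {n} (G : Graph n) {w w' : Fin n} → FalseTwins G w w' →
                 ∀ b → b ≢ w' → adj G w b ≡ adj G w' b
FalseTwins-adj G {w} {w'} (w≁w' , same) b b≢w' with b ≟ w
... | yes refl = trans (irrefl G b) (sym (trans (Graph.sym G w' b) w≁w'))
... | no  b≢w  = same b b≢w b≢w'

symmetrize-twin : ∀ {n} (G : Graph n) (v : Fin n) {w w' : Fin n} → FalseTwins G w w' →
  ∀ {a b} → a ≢ w' → b ≢ w' → adj (symmetrize G v w) a b ≡ adj (symmetrize G v w') a b
symmetrize-twin G v {w} {w'} twins {a} {b} a≢w' b≢w' with a ≟ v | b ≟ v
... | yes _ | yes _ = trans (irrefl G w) (sym (irrefl G w'))
... | yes _ | no  _ = FalseTwins-adj G twins b b≢w'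
... | no  _ | yes _ = trans (Graph.sym G a w) (trans (FalseTwins-adj G twins a a≢w') (Graph.sym G w' a))
... | no  _ | no  _ = refl

contains-of-symmetrize : ∀ {n} (G : Graph n) (v : Fin n) {w w' : Fin n} → FalseTwins G w w' →
  ∀ {W R} (c : Contains (symmetrize G v w) W R) → (∀ x → proj₁ c x ≢ w') → Contains G W R
contains-of-symmetrize G v {w} {w'} twins (f , f-inj , f-hom) f≢w' =
    redirect v w' ∘ f
  , (λ x y eq → f-inj x y (redirect-injective-off v w' (f≢w' x) (f≢w' y) eq))
  , (λ x y r → subst T (symmetrize-twin G v twins (f≢w' x) (f≢w' y)) (f-hom x y r))

Enumerates : ∀ {A : Set} → List A → Set
Enumerates xs = ∀ x → x ∈ xs

symmetrize-free : ∀ {n} {G : Graph n} {W : Set} {R : W → W → Set} {xs : List W} →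
  ¬ Contains G W R → Enumerates xs → ∀ v w (P : Fin n → Bool) →
  (∀ z → T (P z) → FalseTwins G w z) → length xs < count P →
  ¬ Contains (symmetrize G v w) W R
symmetrize-free {G = G} {xs = xs} free all-xs v w P twins xs<P c@(f , _) =
  free (contains-of-symmetrize G v (twins w' Pw') c f≢w')
  where
  fresh : ∃[ z ] T (P z) × z ∉ map f xs
  fresh = ∃-∉ P (map f xs) (subst (_< count P) (sym (length-map f xs)) xs<P)
  w' = proj₁ fresh
  Pw' = proj₁ (proj₂ fresh)
  f≢w' : ∀ x → f x ≢ w'
  f≢w' x fx≡w' = proj₂ (proj₂ fresh) (subst (_∈ map f xs) fx≡w' (∈-map⁺ f (all-xs x)))

module _ {n p r : ℕ} {G : Graph n} (D : SingletonDecomp G p r) where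

  inA-part : ∀ {i z} → T (inA (part D) i z) → part D z ≡ just i
  inA-part {i} {z} z∈Aᵢ with part D z
  ... | just m with m ≟ i
  ...   | yes refl = refl
  inA-part () | just m | no _
  inA-part () | nothing

  parts-large : ∀ {m} .{{_ : NonZero p}} → p * m + p * r ≤ n → ∀ i → m ≤ count (inA (part D) i)
  parts-large {m} bound i =
    *-cancelˡ-≤ p (+-cancelʳ-≤ (p * r) (p * m) _ (≤-trans bound (size-lo D i)))

  part-falseTwins : ∀ {x y i} → part D x ≡ just i → part D y ≡ just i → FalseTwins G x y
  part-falseTwins {x} {y} {i} px py = indep D x y i px py , same
    where
    same : ∀ b → b ≢ x → b ≢ y → adj G x b ≡ adj G y b
    same b b≢x b≢y with x ≟ y
    ... | yes refl = refl
    ... | no  x≢y  = symm D x y i px py x≢y b b≢x b≢y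

  B-misses-part : ∀ {i j v u} → InB D i v → part D u ≡ just j → adj G v u ≡ false →
                  ∀ z → part D z ≡ just j → adj G v z ≡ false
  B-misses-part {j = j} {v} {u} v∈B pu v≁u z pz with z ≟ u
  ... | yes refl = v≁u
  ... | no  z≢u  = begin
    adj G v z ≡⟨ Graph.sym G v z ⟩
    adj G z v ≡⟨ symm D z u j pz pu z≢u v (undeleted pz) (undeleted pu) ⟩
    adj G u v ≡⟨ Graph.sym G u v ⟩
    adj G v u ≡⟨ v≁u ⟩
    false     ∎
    where
    open ≡-Reasoning
    undeleted : ∀ {x m} → part D x ≡ just m → v ≢ x
    undeleted px refl = case trans (sym px) (proj₁ v∈B) of λ ()

  degree-B-< : ∀ {i j v w} → InB D i v → part D w ≡ just i → j ≢ i →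
               (∀ z → part D z ≡ just j → adj G v z ≡ false) → r ≤ count (inA (part D) j) →
               degree G v < degree G w
  degree-B-< {i} {j} {v} {w} v∈B pw j≢i v≁Aⱼ r≤Aⱼ =
    +-cancelʳ-< (count Aⱼ) (degree G v) (degree G w) (begin-strict
      degree G v + count Aⱼ                         ≡⟨ cong (degree G v +_) (count≡sum Aⱼ) ⟩
      degree G v + sum (𝟙 ∘ Aⱼ)                     ≡⟨ ∑-distrib-+ (𝟙 ∘ adj G v) (𝟙 ∘ Aⱼ) ⟨
      sum (λ z → 𝟙 (adj G v z) + 𝟙 (Aⱼ z))          <⟨ ∑-mono-< pointwise v at-v ⟩
      sum (λ z → 𝟙 (adj G w z) + 𝟙 (deleted z))    ≡⟨ ∑-distrib-+ (𝟙 ∘ adj G w) (𝟙 ∘ deleted) ⟩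
      degree G w + sum (𝟙 ∘ deleted)                ≡⟨ cong (degree G w +_) (count≡sum deleted) ⟨
      degree G w + count deleted                    ≤⟨ +-monoʳ-≤ (degree G w) (≤-trans (few-deleted D) r≤Aⱼ) ⟩
      degree G w + count Aⱼ                         ∎)
    where
    open ≤-Reasoning
    Aⱼ deleted : Fin n → Bool
    Aⱼ = inA (part D) j
    deleted = isDeleted (part D)

    pointwise : ∀ z → 𝟙 (adj G v z) + 𝟙 (Aⱼ z) ≤ 𝟙 (adj G w z) + 𝟙 (deleted z)
    pointwise z with part D z in pz
    ... | nothing = ≤-trans (≤-reflexive (+-identityʳ _)) (≤-trans (𝟙≤1 (adj G v z)) (m≤n+m 1 _))
    ... | just m with m ≟ j
    ...   | yes refl rewrite v≁Aⱼ z pz | 𝟙-T (join D w z i m pw pz (j≢i ∘ sym)) = ≤-refl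
    ...   | no  _ with m ≟ i
    ...     | yes refl rewrite proj₂ (proj₂ v∈B) z pz = z≤n
    ...     | no  m≢i  rewrite 𝟙-T (join D w z i m pw pz (m≢i ∘ sym)) = +-monoˡ-≤ 0 (𝟙≤1 (adj G v z))

    at-v : 𝟙 (adj G v v) + 𝟙 (Aⱼ v) < 𝟙 (adj G w v) + 𝟙 (deleted v)
    at-v rewrite irrefl G v | proj₁ v∈B = m≤n+m 1 _

B-complete-to-other-parts :
  ∀ {n p r} {H : PatternGraph} {G : Graph n} {xs : List (BlowV H p)} → Enumerates xs →
  Extremal H p G → (D : SingletonDecomp G p r) →
  (∀ m → length xs + r < count (inA (part D) m)) →
  ∀ {i j v u} → InB D i v → part D u ≡ just j → j ≢ i → T (adj G v u)
B-complete-to-other-parts {n} {p} {r} {H} {G} {xs} all-xs (free , maximal) D large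
                          {i} {j} {v} {u} v∈B pu j≢i
  with adj G v u in v~u
... | true  = tt
... | false = <⇒≱ (edges-symmetrize G v w w≁v deg<) (maximal (symmetrize G v w) free′)
  where
  w∈Aᵢ : ∃[ z ] T (inA (part D) i z) × z ∉ []
  w∈Aᵢ = ∃-∉ (inA (part D) i) [] (≤-trans (s≤s z≤n) (large i))
  w : Fin n
  w = proj₁ w∈Aᵢ
  pw : part D w ≡ just i
  pw = inA-part D (proj₁ (proj₂ w∈Aᵢ))
  w≁v : adj G w v ≡ false
  w≁v = trans (Graph.sym G w v) (proj₂ (proj₂ v∈B) w pw)
  deg< : degree G v < degree G w
  deg< = degree-B-< D v∈B pw j≢i (B-misses-part D v∈B pu v~u)
           (≤-trans (m≤n+m r (length xs)) (<⇒≤ (large j)))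
  free′ : BlowFree H p (symmetrize G v w)
  free′ = symmetrize-free {G = G} {xs = xs} free all-xs v w (inA (part D) i)
            (λ z z∈Aᵢ → part-falseTwins D pw (inA-part D z∈Aᵢ))
            (≤-trans (s≤s (m≤m+n (length xs) r)) (large i))

⊎-enumerates : ∀ {A B : Set} {xs : List A} {ys : List B} → Enumerates xs → Enumerates ys →
               Enumerates (map inj₁ xs ++ map inj₂ ys)
⊎-enumerates all-xs all-ys (inj₁ x) = ∈-++⁺ˡ (∈-map⁺ inj₁ (all-xs x))
⊎-enumerates {xs = xs} all-xs all-ys (inj₂ y) = ∈-++⁺ʳ (map inj₁ xs) (∈-map⁺ inj₂ (all-ys y))

blowupVertices : (H : PatternGraph) (p : ℕ) → List (V H) → List (E H) → List (BlowV H p)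
blowupVertices H p vs es = map inj₁ vs ++ map inj₂ (cartesianProduct es (allFin (p ∸ 1)))

blowupVertices-enumerates : ∀ {H p} {vs : List (V H)} {es : List (E H)} →
  Enumerates vs → Enumerates es → Enumerates (blowupVertices H p vs es)
blowupVertices-enumerates all-vs all-es =
  ⊎-enumerates all-vs λ (e , s) → ∈-cartesianProduct⁺ (all-es e) (∈-allFin s)

-- Only k ≥ 1 (so that the lollipop has vertices) and p ≥ 1 are needed.
lemma3p4 : (k ℓ p r : ℕ) → 3 ≤ k → 2 ≤ ℓ → 2 ≤ p →
    Σ ℕ (λ N → (n : ℕ) → N ≤ n → (G : Graph n) →
      Extremal (lollipop k ℓ) p G → (D : SingletonDecomp G p r) →
      (i : Fin p) (v : Fin n) → InB D i v →
      (u : Fin n) (j : Fin p) → part D u ≡ just j → j ≢ i → T (adj G v u))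
lemma3p4 (suc k) ℓ (suc p) r _ _ _ = N , λ n N≤n G ext D i v v∈B u j pu j≢i →
  B-complete-to-other-parts all-xs ext D (parts-large D N≤n) v∈B pu j≢i
  where
  cycle-and-path : List (Fin (suc k) ⊎ Fin ℓ)
  cycle-and-path = map inj₁ (allFin (suc k)) ++ map inj₂ (allFin ℓ)
  all-cycle-and-path : Enumerates cycle-and-path
  all-cycle-and-path = ⊎-enumerates ∈-allFin ∈-allFin
  xs : List (BlowV (lollipop (suc k) ℓ) (suc p))
  xs = blowupVertices (lollipop (suc k) ℓ) (suc p) cycle-and-path cycle-and-path
  all-xs : Enumerates xs
  all-xs = blowupVertices-enumerates {lollipop (suc k) ℓ} {suc p} all-cycle-and-path all-cycle-and-path
  N : ℕ
  N = suc p * suc (length xs + r) + suc p * r
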